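{- Let $R$ be a nonzero finite commutative ring with identity, written as a finite direct product $R\cong\prod_i R_i$ of local rings, with $J$ the Jacobson radical of $R$, $J_i$ that of $R_i$, and $q_i=\frac{|R_i|}{|J_i|}$. Let $n\ge1$ and let $p$ be a prime with $p\le n$. Then $p$ divides the integer $$\cap n\mathrm{N}=|J|\sum_{k=0}^n(-1)^k\binom{n}{k}\prod_i(q_i+1-k).$$
   Context: The quantity $\cap n\mathrm{N}$ equals the cardinality of the intersection of the neighbourhoods (complements of the sets of distant points) of $n$ pairwise distant points in the projective line $\mathbb{P}(R)$; for the claim only the displayed formula matters. -}

module Defs where

open import Level using (0ℓ)
open import Data.Nat using (ℕ; zero; suc)
open import Data.Nat.Combinatorics using (_C_)
open import Data.Fin using (Fin; zero; suc)
open import Data.Integer as ℤ using (ℤ; +_)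
open import Data.Product using (Σ; ∃; _×_; proj₁)
open import Relation.Nullary using (¬_)
open import Algebra.Bundles using (CommutativeRing)
open import Relation.Binary.Bundles using (Setoid)
open import Relation.Binary.PropositionalEquality renaming (setoid to ≡-setoid) using ()
open import Function.Bundles using (Bijection)
import Relation.Binary.Construct.On as On
import Algebra.Construct.DirectProduct as DP

HasSize : Setoid 0ℓ 0ℓ → ℕ → Set
HasSize S m = Bijection (≡-setoid (Fin m)) S

module _ (R : CommutativeRing 0ℓ 0ℓ) where
  open CommutativeRing R

  IsUnit : Carrier → Set
  IsUnit x = ∃ λ y → x * y ≈ 1#

  -- Jacobson radical of a commutative ring:
  -- x ∈ J(R)  iff  1 - x y is a unit for every y
  -- (equivalent to the intersection of all maximal ideals).
  InJacobson : Carrier → Set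
  InJacobson x = ∀ y → IsUnit (1# - x * y)

  JacobsonSetoid : Setoid 0ℓ 0ℓ
  JacobsonSetoid = On.setoid {B = Σ Carrier InJacobson} setoid proj₁

  -- Local ring: 1 ≠ 0 and the non-units are closed under addition
  -- (equivalently, the non-units form the unique maximal ideal).
  IsLocal : Set
  IsLocal = (¬ (1# ≈ 0#))
          × (∀ x y → ¬ IsUnit x → ¬ IsUnit y → ¬ IsUnit (x + y))

  RingSetoid : Setoid 0ℓ 0ℓ
  RingSetoid = setoid

∏Ring : ∀ r → (Fin (suc r) → CommutativeRing 0ℓ 0ℓ) → CommutativeRing 0ℓ 0ℓ
∏Ring zero    Rs = Rs zero
∏Ring (suc r) Rs = DP.commutativeRing (Rs zero) (∏Ring r (λ i → Rs (suc i)))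

sumTo : ℕ → (ℕ → ℤ) → ℤ
sumTo zero    f = f 0
sumTo (suc n) f = sumTo n f ℤ.+ f (suc n)

∏ℤ : ∀ r → (Fin r → ℤ) → ℤ
∏ℤ zero    f = + 1
∏ℤ (suc r) f = f zero ℤ.* ∏ℤ r (λ i → f (suc i))

capNN : ∀ r → ℕ → (Fin r → ℕ) → ℕ → ℤ
capNN r jsize q n =
  + jsize ℤ.* sumTo n (λ k →
    ((ℤ.- + 1) ℤ.^ k) ℤ.* (+ (n C k)) ℤ.* ∏ℤ r (λ i → (+ q i) ℤ.+ + 1 ℤ.- + k))

-- Only the arithmetic matters: the integer is |J| times the alternating binomial sum
-- Σₖ (-1)ᵏ (n choose k) f(k) of f(k) = ∏ᵢ (qᵢ + 1 - k), and f(k + p) ≡ f(k) (mod p).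
-- By Pascal's rule the sum for n + 1 is the sum for n of f minus that of k ↦ f(k + 1), which
-- is again periodic mod p, so it suffices to take n = p. There p divides every (p choose k)
-- with 0 < k < p, leaving f(0) + (-1)ᵖ f(p) ≡ f(0) (1 + (-1)ᵖ); and p ∣ 1 + (-1)ᵖ is the
-- same computation for f = 1, whose sum (1 - 1)ᵖ vanishes.
module Submission where

module AlternatingBinomialSums where

  open import Data.Nat as ℕ using (ℕ; zero; suc; _<_; _≤_; _≤′_; ≤′-refl; ≤′-step; s≤s; z≤n)
  import Data.Nat.Properties as ℕ
  import Data.Nat.Divisibility as ℕ
  open import Data.Nat.Combinatorics using (_C_; nCk+nC[k+1]≡[n+1]C[k+1]; nCn≡1; nC1≡n)
  open import Data.Nat.Combinatorics.Specification using (k>n⇒nCk≡0)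
  open import Data.Nat.Primality using (Prime; euclidsLemma)
  open import Data.Fin using (Fin; zero; suc)
  open import Data.Integer using (ℤ; +_; 0ℤ; 1ℤ; -1ℤ; _+_; _-_; -_; _*_; _^_)
  import Data.Integer.Properties as ℤ
  open import Data.Integer.Divisibility.Signed
  open import Data.Integer.Tactic.RingSolver using (solve-∀)
  open import Data.Sum using (inj₁; inj₂)
  open import Data.Empty using (⊥-elim)
  open import Function using (_∘_)
  open import Relation.Binary.PropositionalEquality using (_≡_; refl; sym; trans; cong; cong₂; subst; module ≡-Reasoning)
  open import Defs using (sumTo; ∏ℤ)

  sumTo-shiftedDifference : ∀ m {g a b : ℕ → ℤ} → g 0 ≡ a 0 → (∀ k → g (suc k) ≡ a (suc k) - b k) →
    sumTo (suc m) g ≡ sumTo (suc m) a - sumTo m b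
  sumTo-shiftedDifference zero {g} {a} {b} g0 gsuc = begin
    g 0 + g 1           ≡⟨ cong₂ _+_ g0 (gsuc 0) ⟩
    a 0 + (a 1 - b 0)   ≡⟨ ℤ.+-assoc (a 0) (a 1) (- b 0) ⟨
    a 0 + a 1 - b 0     ∎
    where open ≡-Reasoning
  sumTo-shiftedDifference (suc m) {g} {a} {b} g0 gsuc = begin
    sumTo (suc m) g + g (suc (suc m))
      ≡⟨ cong₂ _+_ (sumTo-shiftedDifference m g0 gsuc) (gsuc (suc m)) ⟩
    (sumTo (suc m) a - sumTo m b) + (a (suc (suc m)) - b (suc m))
      ≡⟨ regroup (sumTo (suc m) a) (sumTo m b) (a (suc (suc m))) (b (suc m)) ⟩
    (sumTo (suc m) a + a (suc (suc m))) - (sumTo m b + b (suc m)) ∎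
    where
    open ≡-Reasoning
    regroup : ∀ w x y z → (w - x) + (y - z) ≡ (w + y) - (x + z)
    regroup = solve-∀

  binomialTerm : ℕ → (ℕ → ℤ) → ℕ → ℤ
  binomialTerm n f k = -1ℤ ^ k * + (n C k) * f k

  alternatingSumUpTo : ℕ → ℕ → (ℕ → ℤ) → ℤ
  alternatingSumUpTo m n f = sumTo m (binomialTerm n f)

  alternatingSum : ℕ → (ℕ → ℤ) → ℤ
  alternatingSum n f = alternatingSumUpTo n n f

  binomialTerm-pascal : ∀ n f k →
    binomialTerm (suc n) f (suc k) ≡ binomialTerm n f (suc k) - binomialTerm n (f ∘ suc) k
  binomialTerm-pascal n f k = begin
    -1ℤ * -1ℤ ^ k * + (suc n C suc k) * f (suc k)
      ≡⟨ cong (λ c → -1ℤ * -1ℤ ^ k * + c * f (suc k)) (sym (nCk+nC[k+1]≡[n+1]C[k+1] n k)) ⟩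
    -1ℤ * -1ℤ ^ k * (+ (n C k) + + (n C suc k)) * f (suc k)
      ≡⟨ distribute (-1ℤ ^ k) (+ (n C k)) (+ (n C suc k)) (f (suc k)) ⟩
    -1ℤ * -1ℤ ^ k * + (n C suc k) * f (suc k) - -1ℤ ^ k * + (n C k) * f (suc k) ∎
    where
    open ≡-Reasoning
    distribute : ∀ s a b x → -1ℤ * s * (a + b) * x ≡ -1ℤ * s * b * x - s * a * x
    distribute = solve-∀

  binomialTerm-vanishes : ∀ {n k} f → n < k → binomialTerm n f k ≡ 0ℤ
  binomialTerm-vanishes {n} {k} f n<k = begin
    -1ℤ ^ k * + (n C k) * f k  ≡⟨ cong (λ c → -1ℤ ^ k * + c * f k) (k>n⇒nCk≡0 n<k) ⟩
    -1ℤ ^ k * 0ℤ * f k         ≡⟨ cong (_* f k) (ℤ.*-zeroʳ (-1ℤ ^ k)) ⟩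
    0ℤ * f k                   ≡⟨ ℤ.*-zeroˡ (f k) ⟩
    0ℤ                         ∎
    where open ≡-Reasoning

  alternatingSum-pascal : ∀ n f → alternatingSum (suc n) f ≡ alternatingSum n f - alternatingSum n (f ∘ suc)
  alternatingSum-pascal n f = begin
    alternatingSumUpTo (suc n) (suc n) f
      ≡⟨ sumTo-shiftedDifference n refl (binomialTerm-pascal n f) ⟩
    alternatingSumUpTo n n f + binomialTerm n f (suc n) - alternatingSum n (f ∘ suc)
      ≡⟨ cong (λ t → alternatingSum n f + t - alternatingSum n (f ∘ suc)) (binomialTerm-vanishes f (ℕ.n<1+n n)) ⟩
    alternatingSum n f + 0ℤ - alternatingSum n (f ∘ suc)
      ≡⟨ cong (_- alternatingSum n (f ∘ suc)) (ℤ.+-identityʳ (alternatingSum n f)) ⟩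
    alternatingSum n f - alternatingSum n (f ∘ suc) ∎
    where open ≡-Reasoning

  alternatingSum-const≡0 : ∀ n c → alternatingSum (suc n) (λ _ → c) ≡ 0ℤ
  alternatingSum-const≡0 n c = trans (alternatingSum-pascal n (λ _ → c)) (ℤ.+-inverseʳ (alternatingSum n (λ _ → c)))

  alternatingSum-last : ∀ m f → alternatingSum (suc m) f ≡ alternatingSumUpTo m (suc m) f + -1ℤ ^ suc m * f (suc m)
  alternatingSum-last m f = trans
    (cong (λ c → alternatingSumUpTo m (suc m) f + -1ℤ ^ suc m * + c * f (suc m)) (nCn≡1 (suc m)))
    (cong (λ s → alternatingSumUpTo m (suc m) f + s * f (suc m)) (ℤ.*-identityʳ (-1ℤ ^ suc m)))

  [1+k]*[1+n]C[1+k]≡[1+n]*nCk : ∀ n k → suc k ℕ.* (suc n C suc k) ≡ suc n ℕ.* (n C k)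
  [1+k]*[1+n]C[1+k]≡[1+n]*nCk zero    zero    = refl
  [1+k]*[1+n]C[1+k]≡[1+n]*nCk zero    (suc k) = ℕ.*-zeroʳ (suc (suc k))
  [1+k]*[1+n]C[1+k]≡[1+n]*nCk (suc n) zero    = trans (ℕ.*-identityˡ _) (trans (nC1≡n (suc (suc n))) (sym (ℕ.*-identityʳ _)))
  [1+k]*[1+n]C[1+k]≡[1+n]*nCk (suc n) (suc k) = begin
    suc (suc k) ℕ.* (suc (suc n) C suc (suc k))
      ≡⟨ cong (suc (suc k) ℕ.*_) (nCk+nC[k+1]≡[n+1]C[k+1] (suc n) (suc k)) ⟨
    suc (suc k) ℕ.* (suc n C suc k ℕ.+ suc n C suc (suc k))
      ≡⟨ ℕ.*-distribˡ-+ (suc (suc k)) (suc n C suc k) _ ⟩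
    suc n C suc k ℕ.+ suc k ℕ.* (suc n C suc k) ℕ.+ suc (suc k) ℕ.* (suc n C suc (suc k))
      ≡⟨ cong₂ (λ x y → suc n C suc k ℕ.+ x ℕ.+ y) ([1+k]*[1+n]C[1+k]≡[1+n]*nCk n k) ([1+k]*[1+n]C[1+k]≡[1+n]*nCk n (suc k)) ⟩
    suc n C suc k ℕ.+ suc n ℕ.* (n C k) ℕ.+ suc n ℕ.* (n C suc k)
      ≡⟨ ℕ.+-assoc (suc n C suc k) _ _ ⟩
    suc n C suc k ℕ.+ (suc n ℕ.* (n C k) ℕ.+ suc n ℕ.* (n C suc k))
      ≡⟨ cong (suc n C suc k ℕ.+_) (ℕ.*-distribˡ-+ (suc n) (n C k) _) ⟨
    suc n C suc k ℕ.+ suc n ℕ.* (n C k ℕ.+ n C suc k)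
      ≡⟨ cong (λ c → suc n C suc k ℕ.+ suc n ℕ.* c) (nCk+nC[k+1]≡[n+1]C[k+1] n k) ⟩
    suc (suc n) ℕ.* (suc n C suc k) ∎
    where open ≡-Reasoning

  prime∣pCk : ∀ {p k} → Prime p → 0 < k → k < p → p ℕ.∣ p C k
  prime∣pCk {suc n} {suc k} pp _ k<p
    with euclidsLemma (suc k) (suc n C suc k) pp
           (subst (suc n ℕ.∣_) (sym ([1+k]*[1+n]C[1+k]≡[1+n]*nCk n k)) (ℕ.m∣m*n (n C k)))
  ... | inj₁ p∣k = ⊥-elim (ℕ.<⇒≱ k<p (ℕ.∣⇒≤ p∣k))
  ... | inj₂ p∣C = p∣C

  n∣0 : ∀ n → n ∣ 0ℤ
  n∣0 n = divides 0ℤ (sym (ℤ.*-zeroˡ n))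

  PeriodicMod : ℕ → (ℕ → ℤ) → Set
  PeriodicMod d f = ∀ k → + d ∣ f (k ℕ.+ d) - f k

  periodicMod-linear : ∀ d a → PeriodicMod d (λ k → a - + k)
  periodicMod-linear d a k = subst (+ d ∣_) (sym difference) (∣m⇒∣-m ∣-refl)
    where
    cancel : ∀ a k d → (a - (k + d)) - (a - k) ≡ - d
    cancel = solve-∀
    difference : (a - + (k ℕ.+ d)) - (a - + k) ≡ - + d
    difference = trans (cong (λ x → (a - x) - (a - + k)) (ℤ.pos-+ k d)) (cancel a (+ k) (+ d))

  periodicMod-* : ∀ {d f g} → PeriodicMod d f → PeriodicMod d g → PeriodicMod d (λ k → f k * g k)
  periodicMod-* {d} {f} {g} pf pg k = subst (+ d ∣_) (expand (f (k ℕ.+ d)) (g (k ℕ.+ d)) (f k) (g k))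
    (∣m∣n⇒∣m+n (∣n⇒∣m*n (f (k ℕ.+ d)) (pg k)) (∣n⇒∣m*n (g k) (pf k)))
    where
    expand : ∀ x y x′ y′ → x * (y - y′) + y′ * (x - x′) ≡ x * y - x′ * y′
    expand = solve-∀

  periodicMod-∏ : ∀ {d} r (a : Fin r → ℕ → ℤ) → (∀ i → PeriodicMod d (a i)) →
    PeriodicMod d (λ k → ∏ℤ r (λ i → a i k))
  periodicMod-∏ {d} zero    _ _        k = subst (+ d ∣_) (sym (ℤ.+-inverseʳ 1ℤ)) (n∣0 (+ d))
  periodicMod-∏     (suc r) a periodic   =
    periodicMod-* {f = a zero} (periodic zero) (periodicMod-∏ r (a ∘ suc) (periodic ∘ suc))

  prime∣alternatingSumUpTo-head : ∀ {p} → Prime p → ∀ f m → m < p → + p ∣ alternatingSumUpTo m p f - f 0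
  prime∣alternatingSumUpTo-head {p} pp f zero _ =
    subst (+ p ∣_) (sym (trans (cong (_- f 0) (ℤ.*-identityˡ (f 0))) (ℤ.+-inverseʳ (f 0)))) (n∣0 (+ p))
  prime∣alternatingSumUpTo-head {p} pp f (suc m) m<p =
    subst (+ p ∣_) (regroup (alternatingSumUpTo m p f) (f 0) (binomialTerm p f (suc m)))
      (∣m∣n⇒∣m+n (prime∣alternatingSumUpTo-head pp f m (ℕ.<-trans (ℕ.n<1+n m) m<p)) p∣term)
    where
    p∣term : + p ∣ binomialTerm p f (suc m)
    p∣term = ∣m⇒∣m*n (f (suc m)) (∣n⇒∣m*n (-1ℤ ^ suc m) (∣ᵤ⇒∣ (prime∣pCk pp (s≤s z≤n) m<p)))
    regroup : ∀ s x t → (s - x) + t ≡ (s + t) - x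
    regroup = solve-∀

  prime∣1+[-1]^p : ∀ {p} → Prime p → + p ∣ 1ℤ + -1ℤ ^ p
  prime∣1+[-1]^p {suc m} pp = ∣m+n∣m⇒∣n (subst (+ suc m ∣_) sum≡0 (n∣0 (+ suc m)))
    (prime∣alternatingSumUpTo-head pp one m (ℕ.n<1+n m))
    where
    one : ℕ → ℤ
    one _ = 1ℤ
    regroup : ∀ s t → s + t * 1ℤ ≡ (s - 1ℤ) + (1ℤ + t)
    regroup = solve-∀
    sum≡0 : 0ℤ ≡ (alternatingSumUpTo m (suc m) one - 1ℤ) + (1ℤ + -1ℤ ^ suc m)
    sum≡0 = begin
      0ℤ                                                           ≡⟨ alternatingSum-const≡0 m 1ℤ ⟨
      alternatingSum (suc m) one                                   ≡⟨ alternatingSum-last m one ⟩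
      alternatingSumUpTo m (suc m) one + -1ℤ ^ suc m * 1ℤ          ≡⟨ regroup (alternatingSumUpTo m (suc m) one) (-1ℤ ^ suc m) ⟩
      (alternatingSumUpTo m (suc m) one - 1ℤ) + (1ℤ + -1ℤ ^ suc m) ∎
      where open ≡-Reasoning

  prime∣alternatingSum-self : ∀ {p f} → Prime p → PeriodicMod p f → + p ∣ alternatingSum p f
  prime∣alternatingSum-self {suc m} {f} pp periodic = subst (+ suc m ∣_) (sym sum≡) divisible
    where
    s = -1ℤ ^ suc m
    regroup : ∀ t s y x → t + s * y ≡ (t - x) + s * (y - x) + x * (1ℤ + s)
    regroup = solve-∀
    sum≡ : alternatingSum (suc m) f ≡ (alternatingSumUpTo m (suc m) f - f 0) + s * (f (suc m) - f 0) + f 0 * (1ℤ + s)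
    sum≡ = trans (alternatingSum-last m f) (regroup (alternatingSumUpTo m (suc m) f) s (f (suc m)) (f 0))
    divisible : + suc m ∣ (alternatingSumUpTo m (suc m) f - f 0) + s * (f (suc m) - f 0) + f 0 * (1ℤ + s)
    divisible = ∣m∣n⇒∣m+n (∣m∣n⇒∣m+n (prime∣alternatingSumUpTo-head pp f m (ℕ.n<1+n m)) (∣n⇒∣m*n s (periodic 0)))
                          (∣n⇒∣m*n (f 0) (prime∣1+[-1]^p pp))

  prime∣alternatingSum : ∀ {p n f} → Prime p → p ≤ n → PeriodicMod p f → + p ∣ alternatingSum n f
  prime∣alternatingSum {p} pp p≤n = go (ℕ.≤⇒≤′ p≤n)
    where
    go : ∀ {n f} → p ≤′ n → PeriodicMod p f → + p ∣ alternatingSum n f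
    go ≤′-refl                      periodic = prime∣alternatingSum-self pp periodic
    go {suc n} {f} (≤′-step p≤n) periodic = subst (+ p ∣_) (sym (alternatingSum-pascal n f))
      (∣m∣n⇒∣m-n (go {f = f} p≤n periodic) (go {f = f ∘ suc} p≤n (periodic ∘ suc)))

open import Defs
open import Level using (0ℓ)
open import Data.Nat using (ℕ; suc; _≤_; _*_)
open import Data.Nat.Primality using (Prime)
open import Data.Fin using (Fin)
open import Data.Integer using (+_)
open import Data.Integer.Divisibility using (_∣_)
open import Algebra.Bundles using (CommutativeRing)
open import Relation.Binary.PropositionalEquality using (_≡_)

import Data.Integer as ℤ
import Data.Integer.Divisibility.Signed as Signed
open AlternatingBinomialSums using (prime∣alternatingSum; periodicMod-∏; periodicMod-linear)

mainTheorem5 : ∀ (r : ℕ) (Rs : Fin (suc r) → CommutativeRing 0ℓ 0ℓ) →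
    (∀ i → IsLocal (Rs i)) →
    (size jsize q : Fin (suc r) → ℕ) →
    (∀ i → HasSize (RingSetoid (Rs i)) (size i)) →
    (∀ i → HasSize (JacobsonSetoid (Rs i)) (jsize i)) →
    (∀ i → size i ≡ q i * jsize i) →
    (J : ℕ) → HasSize (JacobsonSetoid (∏Ring r Rs)) J →
    (n p : ℕ) → 1 ≤ n → Prime p → p ≤ n →
    (+ p) ∣ capNN (suc r) J q n
mainTheorem5 r _ _ _ _ q _ _ _ J _ _ p _ p-prime p≤n =
  Signed.∣⇒∣ᵤ (Signed.∣n⇒∣m*n (+ J) (prime∣alternatingSum p-prime p≤n
    (periodicMod-∏ (suc r) (λ i k → + q i ℤ.+ + 1 ℤ.- + k) (λ i → periodicMod-linear p (+ q i ℤ.+ + 1)))))
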